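{- Let $t\ge 3$ and let $\mathcal T$ be a triangulation of $n+2$ points $p_1,\ldots,p_{n+2}$ in convex position. Then $\mathcal T$ contains at most one $t$-gonal tiling of $p_1,\ldots,p_{n+2}$ as a subgraph.
   Context: A triangulation of points in convex position is a maximal plane straight-line graph on these points. For $t\ge 3$, a $t$-gonal tiling of $n+2$ points $p_1,\ldots,p_{n+2}$ in convex position (labeled clockwise) is a plane straight-line graph on these points in which every bounded face is a $t$-gon and the vertices along the unbounded face are $p_1,p_2,\ldots,p_{n+2}$ in this order. A tiling is a subgraph of $\mathcal T$ if all its edges are edges of $\mathcal T$. -}

module Defs where

open import Data.Nat using (ℕ; zero; suc; _<_; _≤_; _⊓_; _⊔_)
open import Data.Fin using (Fin; toℕ)
open import Data.Bool using (Bool; true; false)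
open import Data.Product using (_×_)
open import Data.Sum using (_⊎_)
open import Relation.Nullary using (¬_)
open import Relation.Binary.PropositionalEquality using (_≡_; _≢_)

-- Points p_1..p_m in convex position, labelled clockwise, are modelled by
-- Fin m; the cyclic (clockwise) order is the order of toℕ.
Graph : ℕ → Set
Graph m = Fin m → Fin m → Bool

IsGraph : {m : ℕ} → Graph m → Set
IsGraph {m} E = (∀ (a b : Fin m) → E a b ≡ E b a) × (∀ (a : Fin m) → E a a ≡ false)

Between : ℕ → ℕ → ℕ → Set
Between x a b = (a ⊓ b < x) × (x < a ⊔ b)

Outside : ℕ → ℕ → ℕ → Set
Outside x a b = (x < a ⊓ b) ⊎ (a ⊔ b < x)

-- For points in convex position, the segments ab and cd cross (in their
-- relative interiors) iff their endpoints strictly interleave along the cycle.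
Crosses : {m : ℕ} → Fin m → Fin m → Fin m → Fin m → Set
Crosses a b c d =
  (Between (toℕ c) (toℕ a) (toℕ b) × Outside (toℕ d) (toℕ a) (toℕ b)) ⊎
  (Between (toℕ d) (toℕ a) (toℕ b) × Outside (toℕ c) (toℕ a) (toℕ b))

Plane : {m : ℕ} → Graph m → Set
Plane {m} E = ∀ (a b c d : Fin m) → E a b ≡ true → E c d ≡ true → ¬ Crosses a b c d

IsTriangulation : {m : ℕ} → Graph m → Set
IsTriangulation {m} E =
  IsGraph E × Plane E ×
  (∀ (a b : Fin m) → a ≢ b →
     (∀ (c d : Fin m) → E c d ≡ true → ¬ Crosses a b c d) → E a b ≡ true)

SubgraphOf : {m : ℕ} → Graph m → Graph m → Set
SubgraphOf {m} E T = ∀ (a b : Fin m) → E a b ≡ true → T a b ≡ true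

HasHullCycle : {m : ℕ} → Graph m → Set
HasHullCycle {m} E =
  (∀ (i j : Fin m) → toℕ j ≡ suc (toℕ i) → E i j ≡ true) ×
  (∀ (i j : Fin m) → toℕ i ≡ 0 → suc (toℕ j) ≡ m → E j i ≡ true)

-- A bounded face of a plane graph on points in convex position containing the
-- hull cycle: a convex k-gon v_0 < ... < v_{k-1} (k ≥ 3) whose sides are edges
-- and which contains no edge in its interior, i.e. no edge joins two
-- non-consecutive vertices of the polygon.
IsFace : {m : ℕ} → Graph m → (k : ℕ) → (Fin k → Fin m) → Set
IsFace {m} E k v =
  (3 ≤ k) ×
  (∀ (i j : Fin k) → toℕ i < toℕ j → toℕ (v i) < toℕ (v j)) ×
  (∀ (i j : Fin k) → toℕ j ≡ suc (toℕ i) → E (v i) (v j) ≡ true) ×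
  (∀ (i j : Fin k) → toℕ i ≡ 0 → suc (toℕ j) ≡ k → E (v j) (v i) ≡ true) ×
  (∀ (i j : Fin k) → suc (toℕ i) < toℕ j → ¬ (toℕ i ≡ 0 × suc (toℕ j) ≡ k) →
     E (v i) (v j) ≡ false)

IsTiling : {m : ℕ} → ℕ → Graph m → Set
IsTiling {m} t E =
  IsGraph E × Plane E × HasHullCycle E ×
  (∀ (k : ℕ) (v : Fin k → Fin m) → IsFace E k v → k ≡ t)

-- Write t = P + 2 and identify the points with their positions 0, …, m − 1.
-- Every edge xy (x < y) of a t-gonal tiling satisfies y − x ≡ 1 (mod P): the face
-- below xy is bounded by xy and t − 1 edges of smaller span, so this follows by
-- induction on the span. Now let ab be an edge of one tiling E₁ inside T that is
-- missing from another, E₂. As T is plane, no edge of E₂ crosses ab, so ab is a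
-- diagonal of a face of E₂; the boundary of that face from a to b has l edges with
-- 2 ≤ l ≤ P, whence b − a ≡ l (mod P), contradicting b − a ≡ 1.

module Submission where

open import Data.Nat using (ℕ; zero; suc; pred; _≤_; _<_; _+_; _*_; _∸_; z≤n; s≤s; s≤s⁻¹; s<s⁻¹; >-nonZero)
open import Data.Nat.Properties
open import Data.Nat.Induction using (<-wellFounded; Acc; acc)
open import Data.Nat.Tactic.RingSolver using (solve-∀)
open import Data.Fin as Fin using (Fin; toℕ; fromℕ<)
open import Data.Fin.Properties using (toℕ-fromℕ<; fromℕ<-toℕ; toℕ-injective; toℕ<n)
open import Data.Bool using (Bool; true; false)
import Data.Bool as Bool
open import Data.Product using (Σ; ∃₂; ∃-syntax; _×_; _,_; proj₁; proj₂)
open import Data.Sum using (_⊎_; inj₁; inj₂)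
open import Data.Empty using (⊥; ⊥-elim)
open import Data.List using (List; []; _∷_; _++_; length; lookup)
open import Data.List.Properties using (length-++)
open import Data.List.Membership.Propositional using (_∈_)
open import Data.List.Membership.Propositional.Properties using (∈-lookup; ∈-++⁻; ∈-++⁺ˡ; ∈-++⁺ʳ)
open import Data.List.Relation.Unary.Any using (here; there; index)
open import Data.List.Relation.Unary.Any.Properties using (lookup-index)
open import Data.List.Relation.Unary.All as All using ([]; _∷_)
open import Data.List.Relation.Unary.AllPairs using (AllPairs; []; _∷_)
import Data.List.Relation.Unary.AllPairs.Properties as AllPairs
open import Relation.Nullary using (¬_; yes; no; contradiction)
open import Relation.Nullary.Decidable using (_×-dec_)
open import Relation.Unary using (Decidable)
open import Relation.Binary.PropositionalEquality
open import Relation.Binary.Definitions using (tri<; tri≈; tri>)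
open import Defs

record Gap (P x y l : ℕ) : Set where
  constructor gap
  field
    quotient : ℕ
    equation : y ≡ x + l + quotient * P

gap-refl : ∀ {P} x → Gap P x x 0
gap-refl x = gap 0 (sym (trans (+-identityʳ (x + 0)) (+-identityʳ x)))

gap-suc : ∀ {P} x → Gap P x (suc x) 1
gap-suc x = gap 0 (sym (trans (+-identityʳ (x + 1)) (+-comm x 1)))

gap-trans : ∀ {P x y z k l} → Gap P x y k → Gap P y z l → Gap P x z (k + l)
gap-trans {P} {x} {k = k} {l} (gap q₁ refl) (gap q₂ refl) = gap (q₁ + q₂) (rearrange x k l q₁ q₂ P)
  where
    rearrange : ∀ x k l q₁ q₂ P → x + k + q₁ * P + l + q₂ * P ≡ x + (k + l) + (q₁ + q₂) * P
    rearrange = solve-∀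

gap-absorb : ∀ {P x y k} → Gap P x y (k + P) → Gap P x y k
gap-absorb {P} {x} {k = k} (gap q refl) = gap (suc q) (rearrange x k q P)
  where
    rearrange : ∀ x k q P → x + (k + P) + q * P ≡ x + k + suc q * P
    rearrange = solve-∀

residues-distinct : ∀ {P k l q₁ q₂} → k + q₁ * P ≡ l + q₂ * P → k < l → l < k + P → ⊥
residues-distinct {P} {k} {l} {q₁} {q₂} balance k<l l<k+P with q₁ ≤? q₂
... | yes q₁≤q₂ = <-irrefl balance (+-mono-<-≤ k<l (*-monoˡ-≤ P q₁≤q₂))
... | no q₁≰q₂ = <-irrefl (sym balance) (begin-strict
      l + q₂ * P        <⟨ +-monoˡ-< (q₂ * P) l<k+P ⟩
      k + P + q₂ * P    ≡⟨ +-assoc k P (q₂ * P) ⟩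
      k + suc q₂ * P    ≤⟨ +-monoʳ-≤ k (*-monoˡ-≤ P (≰⇒> q₁≰q₂)) ⟩
      k + q₁ * P        ∎)
  where open ≤-Reasoning

gap-unique : ∀ {P x y k l} → Gap P x y k → Gap P x y l → k < l → l < k + P → ⊥
gap-unique {P} {x} {k = k} {l} (gap q₁ refl) (gap q₂ eq) =
  residues-distinct {P} {k} {l} {q₁} {q₂}
    (+-cancelˡ-≡ x _ _ (trans (sym (+-assoc x k (q₁ * P))) (trans eq (+-assoc x l (q₂ * P)))))

minimal-witness : ∀ {p} {Q : ℕ → Set p} → Decidable Q → ∀ {n} → Q n →
                  ∃[ k ] Q k × (∀ {j} → j < k → ¬ Q j)
minimal-witness {Q = Q} Q? {n} = go n (<-wellFounded n)
  where
    go : ∀ n → Acc _<_ n → Q n → ∃[ k ] Q k × (∀ {j} → j < k → ¬ Q j)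
    go n (acc smaller) qn with anyUpTo? Q? n
    ... | yes (j , j<n , qj) = go j (smaller j<n) qj
    ... | no none = n , qn , λ j<n qj → none (_ , j<n , qj)

module _ {m : ℕ} (E : Graph m) where

  -- E as a graph on ℕ, in which the vertices ≥ m are isolated.
  onℕ : ℕ → ℕ → Bool
  onℕ x y with x <? m | y <? m
  ... | yes x<m | yes y<m = E (fromℕ< x<m) (fromℕ< y<m)
  ... | _ | _ = false

  onℕ-fromℕ< : ∀ {x y} (x<m : x < m) (y<m : y < m) → onℕ x y ≡ E (fromℕ< x<m) (fromℕ< y<m)
  onℕ-fromℕ< {x} {y} x<m y<m with x <? m | y <? m
  ... | yes _ | yes _ = refl
  ... | no x≮m | _ = contradiction x<m x≮m
  ... | yes _ | no y≮m = contradiction y<m y≮m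

  onℕ-toℕ : ∀ i j → onℕ (toℕ i) (toℕ j) ≡ E i j
  onℕ-toℕ i j = trans (onℕ-fromℕ< (toℕ<n i) (toℕ<n j))
    (cong₂ E (fromℕ<-toℕ i (toℕ<n i)) (fromℕ<-toℕ j (toℕ<n j)))

  onℕ-bounded : ∀ {x y} → onℕ x y ≡ true → x < m × y < m
  onℕ-bounded {x} {y} _ with x <? m | y <? m
  onℕ-bounded () | no _ | _
  onℕ-bounded () | yes _ | no _
  ... | yes x<m | yes y<m = x<m , y<m

  onℕ-sym : (∀ a b → E a b ≡ E b a) → ∀ x y → onℕ x y ≡ onℕ y x
  onℕ-sym sym-E x y with x <? m | y <? m
  ... | yes _ | yes _ = sym-E _ _
  ... | yes _ | no _ = refl
  ... | no _ | yes _ = refl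
  ... | no _ | no _ = refl

-- Crosses a b c d unfolds to CrossesAt (toℕ a) (toℕ b) (toℕ c) (toℕ d).
CrossesAt : ℕ → ℕ → ℕ → ℕ → Set
CrossesAt a b x y = (Between x a b × Outside y a b) ⊎ (Between y a b × Outside x a b)

crossesAt-from-left : ∀ {a b x y} → a < b → x < a → a < y → y < b → CrossesAt a b x y
crossesAt-from-left {a} {b} a<b x<a a<y y<b rewrite m≤n⇒m⊓n≡m (<⇒≤ a<b) | m≤n⇒m⊔n≡n (<⇒≤ a<b) =
  inj₂ ((a<y , y<b) , inj₁ x<a)

crossesAt-from-right : ∀ {a b x y} → a < b → a < x → x < b → b < y → CrossesAt a b x y
crossesAt-from-right {a} {b} a<b a<x x<b b<y rewrite m≤n⇒m⊓n≡m (<⇒≤ a<b) | m≤n⇒m⊔n≡n (<⇒≤ a<b) =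
  inj₁ ((a<x , x<b) , inj₂ b<y)

lookup-< : ∀ {L} → AllPairs _<_ L → ∀ {i j : Fin (length L)} → toℕ i < toℕ j → lookup L i < lookup L j
lookup-< (x<xs ∷ _) {Fin.zero} {Fin.suc j} _ = All.lookup x<xs (∈-lookup j)
lookup-< (_ ∷ sorted) {Fin.suc i} {Fin.suc j} i<j = lookup-< sorted (s<s⁻¹ i<j)

lookup-<⁻ : ∀ {L} → AllPairs _<_ L → ∀ {i j : Fin (length L)} → lookup L i < lookup L j → toℕ i < toℕ j
lookup-<⁻ sorted {i} {j} lt with <-cmp (toℕ i) (toℕ j)
... | tri< i<j _ _ = i<j
... | tri≈ _ i≡j _ rewrite toℕ-injective i≡j = contradiction lt (<-irrefl refl)
... | tri> _ _ j<i = contradiction lt (<-asym (lookup-< sorted j<i))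

lookup-first : ∀ {L h} → AllPairs _<_ L → h ∈ L → (∀ {z} → z ∈ L → h ≤ z) →
               ∀ i → toℕ i ≡ 0 → lookup L i ≡ h
lookup-first {_ ∷ _} _ (here h≡x) _ Fin.zero _ = sym h≡x
lookup-first (x<xs ∷ _) (there h∈xs) h≤ Fin.zero _ =
  contradiction (h≤ (here refl)) (<⇒≱ (All.lookup x<xs h∈xs))

lookup-first⁻ : ∀ {L h} → AllPairs _<_ L → (∀ {z} → z ∈ L → h ≤ z) →
                ∀ i → lookup L i ≡ h → toℕ i ≡ 0
lookup-first⁻ {_ ∷ _} _ _ Fin.zero _ = refl
lookup-first⁻ (x<xs ∷ _) h≤ (Fin.suc i) refl =
  contradiction (h≤ (here refl)) (<⇒≱ (All.lookup x<xs (∈-lookup i)))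

lookup-last : ∀ {L l} → AllPairs _<_ L → l ∈ L → (∀ {z} → z ∈ L → z ≤ l) →
              ∀ j → suc (toℕ j) ≡ length L → lookup L j ≡ l
lookup-last {_ ∷ []} _ (here l≡x) _ Fin.zero _ = sym l≡x
lookup-last {_ ∷ _ ∷ _} _ _ _ Fin.zero ()
lookup-last (x<xs ∷ sorted) (here refl) ≤l (Fin.suc j) _ =
  contradiction (≤l (there (∈-lookup j))) (<⇒≱ (All.lookup x<xs (∈-lookup j)))
lookup-last (_ ∷ sorted) (there l∈xs) ≤l (Fin.suc j) eq =
  lookup-last sorted l∈xs (λ z∈ → ≤l (there z∈)) j (suc-injective eq)

lookup-last⁻ : ∀ {L l} → AllPairs _<_ L → (∀ {z} → z ∈ L → z ≤ l) →
               ∀ j → lookup L j ≡ l → suc (toℕ j) ≡ length L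
lookup-last⁻ {_ ∷ []} _ _ Fin.zero _ = refl
lookup-last⁻ {_ ∷ _ ∷ _} (x<xs ∷ _) ≤l Fin.zero refl =
  contradiction (≤l (there (here refl))) (<⇒≱ (All.lookup x<xs (here refl)))
lookup-last⁻ (_ ∷ sorted) ≤l (Fin.suc j) eq = cong suc (lookup-last⁻ sorted (λ z∈ → ≤l (there z∈)) j eq)

Ends : ℕ → ℕ → ℕ → ℕ → Set
Ends h l x y = x ≡ h × y ≡ l

module Chains (G : ℕ → ℕ → Bool) where

  -- An x-monotone path h … l with vertex list L whose only chords are pairs in X.
  record Chain (X : ℕ → ℕ → Set) (h l : ℕ) (L : List ℕ) : Set where
    field
      sorted    : AllPairs _<_ L
      first∈    : h ∈ L
      last∈     : l ∈ L
      bounded   : ∀ {z} → z ∈ L → h ≤ z × z ≤ l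
      sides     : ∀ {x y} → x ∈ L → y ∈ L → x < y → (∀ {z} → z ∈ L → x < z → z < y → ⊥) → G x y ≡ true
      chordless : ∀ {x y z} → x ∈ L → y ∈ L → z ∈ L → x < z → z < y → ¬ X x y → G x y ≡ false

  open Chain

  above-first : ∀ {X h l L} → Chain X h l (h ∷ L) → ∀ {y} → y ∈ L → h < y
  above-first c y∈ with sorted c
  ... | h<L ∷ _ = All.lookup h<L y∈

  singleton-chain : ∀ {X v} → Chain X v v (v ∷ [])
  singleton-chain = record
    { sorted    = [] ∷ []
    ; first∈    = here refl
    ; last∈     = here refl
    ; bounded   = λ { (here refl) → ≤-refl , ≤-refl }
    ; sides     = λ { (here refl) (here refl) v<v _ → contradiction v<v (<-irrefl refl) }
    ; chordless = λ { (here refl) (here refl) (here refl) v<v _ _ → contradiction v<v (<-irrefl refl) }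
    }

  edge-chain : ∀ {X u w} → u < w → G u w ≡ true → Chain X u w (u ∷ w ∷ [])
  edge-chain {X} {u} {w} u<w uw = record
    { sorted    = (u<w ∷ []) ∷ [] ∷ []
    ; first∈    = here refl
    ; last∈     = there (here refl)
    ; bounded   = bounds
    ; sides     = sides′
    ; chordless = chordless′
    }
    where
      bounds : ∀ {z} → z ∈ u ∷ w ∷ [] → u ≤ z × z ≤ w
      bounds (here refl) = ≤-refl , <⇒≤ u<w
      bounds (there (here refl)) = <⇒≤ u<w , ≤-refl

      sides′ : ∀ {x y} → x ∈ u ∷ w ∷ [] → y ∈ u ∷ w ∷ [] → x < y →
               (∀ {z} → z ∈ u ∷ w ∷ [] → x < z → z < y → ⊥) → G x y ≡ true
      sides′ (here refl) (here refl) u<u _ = contradiction u<u (<-irrefl refl)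
      sides′ (here refl) (there (here refl)) _ _ = uw
      sides′ (there (here refl)) y∈ w<y _ = contradiction (proj₂ (bounds y∈)) (<⇒≱ w<y)

      chordless′ : ∀ {x y z} → x ∈ u ∷ w ∷ [] → y ∈ u ∷ w ∷ [] → z ∈ u ∷ w ∷ [] →
                   x < z → z < y → ¬ X x y → G x y ≡ false
      chordless′ x∈ _ (here refl) x<u _ _ = contradiction (proj₁ (bounds x∈)) (<⇒≱ x<u)
      chordless′ _ y∈ (there (here refl)) _ w<y _ = contradiction (proj₂ (bounds y∈)) (<⇒≱ w<y)

  join : ∀ {X h c l L₁ L₂} → Chain X h c L₁ → Chain X c l (c ∷ L₂) →
         (∀ {x y} → x ∈ L₁ → y ∈ L₂ → x < c → ¬ X x y → G x y ≡ false) →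
         Chain X h l (L₁ ++ L₂)
  join {X} {h} {c} {l} {L₁} {L₂} C₁ C₂ cross = record
    { sorted    = AllPairs.++⁺ (sorted C₁) sorted₂
                    (All.tabulate λ x∈ → All.tabulate λ y∈ → ≤-<-trans (below x∈) (above y∈))
    ; first∈    = ∈-++⁺ˡ (first∈ C₁)
    ; last∈     = last∈′ (last∈ C₂)
    ; bounded   = bounds
    ; sides     = sides′
    ; chordless = chordless′
    }
    where
      L = L₁ ++ L₂
      sorted₂ : AllPairs _<_ L₂
      sorted₂ with sorted C₂
      ... | _ ∷ s = s
      below : ∀ {x} → x ∈ L₁ → x ≤ c
      below x∈ = proj₂ (bounded C₁ x∈)
      above : ∀ {y} → y ∈ L₂ → c < y
      above = above-first C₂
      c≤l : c ≤ l
      c≤l = proj₂ (bounded C₂ (here refl))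
      in₁ : ∀ {z} → z ∈ L₁ → z ∈ L
      in₁ = ∈-++⁺ˡ
      in₂ : ∀ {z} → z ∈ L₂ → z ∈ L
      in₂ = ∈-++⁺ʳ L₁
      c∈ : c ∈ L
      c∈ = in₁ (last∈ C₁)
      last∈′ : l ∈ c ∷ L₂ → l ∈ L
      last∈′ (here refl) = c∈
      last∈′ (there l∈) = in₂ l∈
      only₁ : ∀ {z} → z ∈ L → z ≤ c → z ∈ L₁
      only₁ z∈ z≤c with ∈-++⁻ L₁ z∈
      ... | inj₁ z∈₁ = z∈₁
      ... | inj₂ z∈₂ = contradiction z≤c (<⇒≱ (above z∈₂))
      only₂ : ∀ {z} → z ∈ L → c < z → z ∈ L₂
      only₂ z∈ c<z with ∈-++⁻ L₁ z∈
      ... | inj₁ z∈₁ = contradiction (below z∈₁) (<⇒≱ c<z)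
      ... | inj₂ z∈₂ = z∈₂
      bounds : ∀ {z} → z ∈ L → h ≤ z × z ≤ l
      bounds z∈ with ∈-++⁻ L₁ z∈
      ... | inj₁ z∈₁ = proj₁ (bounded C₁ z∈₁) , ≤-trans (below z∈₁) c≤l
      ... | inj₂ z∈₂ =
        ≤-trans (proj₁ (bounded C₁ (last∈ C₁))) (<⇒≤ (above z∈₂)) , proj₂ (bounded C₂ (there z∈₂))
      sides′ : ∀ {x y} → x ∈ L → y ∈ L → x < y → (∀ {z} → z ∈ L → x < z → z < y → ⊥) → G x y ≡ true
      sides′ x∈ y∈ x<y clear with ∈-++⁻ L₁ x∈ | ∈-++⁻ L₁ y∈
      ... | inj₁ x∈₁ | inj₁ y∈₁ = sides C₁ x∈₁ y∈₁ x<y (λ z∈ → clear (in₁ z∈))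
      ... | inj₂ x∈₂ | inj₂ y∈₂ = sides C₂ (there x∈₂) (there y∈₂) x<y clear₂
        where
          clear₂ : ∀ {z} → z ∈ c ∷ L₂ → _ < z → z < _ → ⊥
          clear₂ (here refl) x<c _ = <-asym x<c (above x∈₂)
          clear₂ (there z∈) = clear (in₂ z∈)
      ... | inj₂ x∈₂ | inj₁ y∈₁ = contradiction (≤-trans (<⇒≤ x<y) (below y∈₁)) (<⇒≱ (above x∈₂))
      ... | inj₁ x∈₁ | inj₂ y∈₂ with m≤n⇒m<n∨m≡n (below x∈₁)
      ...   | inj₁ x<c = ⊥-elim (clear c∈ x<c (above y∈₂))
      ...   | inj₂ refl = sides C₂ (here refl) (there y∈₂) x<y clear₂
        where
          clear₂ : ∀ {z} → z ∈ c ∷ L₂ → c < z → z < _ → ⊥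
          clear₂ (here refl) c<c _ = <-irrefl refl c<c
          clear₂ (there z∈) = clear (in₂ z∈)
      chordless′ : ∀ {x y z} → x ∈ L → y ∈ L → z ∈ L → x < z → z < y → ¬ X x y → G x y ≡ false
      chordless′ x∈ y∈ z∈ x<z z<y free with ∈-++⁻ L₁ x∈ | ∈-++⁻ L₁ y∈
      ... | inj₁ x∈₁ | inj₁ y∈₁ =
        chordless C₁ x∈₁ y∈₁ (only₁ z∈ (<⇒≤ (<-≤-trans z<y (below y∈₁)))) x<z z<y free
      ... | inj₂ x∈₂ | inj₂ y∈₂ =
        chordless C₂ (there x∈₂) (there y∈₂) (there (only₂ z∈ (<-trans (above x∈₂) x<z))) x<z z<y free
      ... | inj₂ x∈₂ | inj₁ y∈₁ =
        contradiction (≤-trans (<⇒≤ (<-trans x<z z<y)) (below y∈₁)) (<⇒≱ (above x∈₂))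
      ... | inj₁ x∈₁ | inj₂ y∈₂ with m≤n⇒m<n∨m≡n (below x∈₁)
      ...   | inj₁ x<c = cross x∈₁ y∈₂ x<c free
      ...   | inj₂ refl = chordless C₂ (here refl) (there y∈₂) (there (only₂ z∈ x<z)) x<z z<y free

module Greedy (G : ℕ → ℕ → Bool) {m : ℕ} (hull : ∀ u → suc u < m → G u (suc u) ≡ true) where

  open Chains G
  open Chain

  record Farthest (u v w : ℕ) : Set where
    field
      u<w    : u < w
      w≤v    : w ≤ v
      edge   : G u w ≡ true
      beyond : ∀ {s} → w < s → s ≤ v → G u s ≡ false

  farthest : ∀ {u v} → u < v → v < m → ∃[ w ] Farthest u v w
  farthest {u} {suc v} u<v v<m with G u (suc v) in uv
  ... | true = suc v , record
    { u<w = u<v ; w≤v = ≤-refl ; edge = uv ; beyond = λ v<s s≤v → contradiction s≤v (<⇒≱ v<s) }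
  ... | false with m≤n⇒m<n∨m≡n (s≤s⁻¹ u<v)
  ...   | inj₂ refl = contradiction (trans (sym uv) (hull u v<m)) λ ()
  ...   | inj₁ u<v′ with farthest u<v′ (<-trans (n<1+n v) v<m)
  ...     | w , f = w , record { u<w = u<w ; w≤v = m≤n⇒m≤1+n w≤v ; edge = edge ; beyond = beyond′ }
    where
      open Farthest f
      beyond′ : ∀ {s} → w < s → s ≤ suc v → G u s ≡ false
      beyond′ {s} w<s s≤v with m≤n⇒m<n∨m≡n s≤v
      ... | inj₁ s<v = beyond w<s (s≤s⁻¹ s<v)
      ... | inj₂ refl = uv

  data GreedyPath (v : ℕ) : ℕ → List ℕ → Set where
    done : GreedyPath v v []
    step : ∀ {u w ws} → Farthest u v w → GreedyPath v w ws → GreedyPath v u (w ∷ ws)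

  greedyPath : ∀ {u v} → u ≤ v → v < m → ∃[ ws ] GreedyPath v u ws
  greedyPath {u} {v} u≤v v<m = go u (<-wellFounded (v ∸ u)) u≤v
    where
      go : ∀ u → Acc _<_ (v ∸ u) → u ≤ v → ∃[ ws ] GreedyPath v u ws
      go u (acc smaller) u≤v with m≤n⇒m<n∨m≡n u≤v
      ... | inj₂ refl = [] , done
      ... | inj₁ u<v with farthest u<v v<m
      ...   | w , f with go w (smaller (∸-monoʳ-< (Farthest.u<w f) (Farthest.w≤v f))) (Farthest.w≤v f)
      ...     | ws , path = w ∷ ws , step f path

  greedy-chain : ∀ {X u v ws} → GreedyPath v u ws → Chain X u v (u ∷ ws)
  greedy-chain done = singleton-chain
  greedy-chain {X} {u} (step {w = w} {ws} f path) = join (edge-chain u<w edge) rest cross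
    where
      open Farthest f
      rest : Chain X w _ (w ∷ ws)
      rest = greedy-chain path
      cross : ∀ {x y} → x ∈ u ∷ w ∷ [] → y ∈ ws → x < w → ¬ X x y → G x y ≡ false
      cross (here refl) y∈ _ _ = beyond (above-first rest y∈) (proj₂ (bounded rest (there y∈)))
      cross (there (here refl)) _ w<w _ = contradiction w<w (<-irrefl refl)

  greedy-gap : ∀ {P u v ws} → GreedyPath v u ws →
               (∀ {x y} → u ≤ x → x < y → y ≤ v → G x y ≡ true → Gap P x y 1) →
               Gap P u v (length ws)
  greedy-gap {u = v} done _ = gap-refl v
  greedy-gap (step f path) edge-gap =
    gap-trans (edge-gap ≤-refl u<w w≤v edge) (greedy-gap path λ w≤x → edge-gap (≤-trans (<⇒≤ u<w) w≤x))
    where open Farthest f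

  greedy-[] : ∀ {u v} → GreedyPath v u [] → u ≡ v
  greedy-[] done = refl

  greedy-nonempty : ∀ {u v ws} → GreedyPath v u ws → u < v → 1 ≤ length ws
  greedy-nonempty done u<u = contradiction u<u (<-irrefl refl)
  greedy-nonempty (step _ _) _ = s≤s z≤n

  greedy-long : ∀ {u v ws} → GreedyPath v u ws → u < v → G u v ≡ false → 2 ≤ length ws
  greedy-long done u<u _ = contradiction u<u (<-irrefl refl)
  greedy-long (step f done) _ uv = contradiction (trans (sym uv) (Farthest.edge f)) λ ()
  greedy-long (step _ (step _ _)) _ _ = s≤s (s≤s z≤n)

module _ {m : ℕ} (E : Graph m) where

  open Chains (onℕ E)
  open Chain

  chain-face : ∀ {h l L} → Chain (Ends h l) h l L → onℕ E l h ≡ true → 3 ≤ length L →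
               Σ (Fin (length L) → Fin m) (IsFace E (length L))
  chain-face {h} {l} {L} c closing three = vertex , three , increasing , consecutive , closed , no-chord
    where
      lookup<m : ∀ i → lookup L i < m
      lookup<m i = ≤-<-trans (proj₂ (bounded c (∈-lookup i))) (proj₁ (onℕ-bounded E closing))

      vertex : Fin (length L) → Fin m
      vertex i = fromℕ< (lookup<m i)

      toℕ-vertex : ∀ i → toℕ (vertex i) ≡ lookup L i
      toℕ-vertex i = toℕ-fromℕ< _

      E-vertex : ∀ i j → E (vertex i) (vertex j) ≡ onℕ E (lookup L i) (lookup L j)
      E-vertex i j = sym (onℕ-fromℕ< E (lookup<m i) (lookup<m j))

      increasing : ∀ i j → toℕ i < toℕ j → toℕ (vertex i) < toℕ (vertex j)
      increasing i j i<j = subst₂ _<_ (sym (toℕ-vertex i)) (sym (toℕ-vertex j)) (lookup-< (sorted c) i<j)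

      consecutive : ∀ i j → toℕ j ≡ suc (toℕ i) → E (vertex i) (vertex j) ≡ true
      consecutive i j j≡1+i =
        trans (E-vertex i j)
              (sides c (∈-lookup i) (∈-lookup j) (lookup-< (sorted c) (≤-reflexive (sym j≡1+i))) clear)
        where
          clear : ∀ {z} → z ∈ L → lookup L i < z → z < lookup L j → ⊥
          clear z∈ i<z z<j = <⇒≱ (lookup-<⁻ (sorted c) (subst (_< _) z≡ z<j))
                                 (subst (_≤ _) (sym j≡1+i) (lookup-<⁻ (sorted c) (subst (_ <_) z≡ i<z)))
            where
              z≡ : _ ≡ lookup L (index z∈)
              z≡ = lookup-index z∈

      closed : ∀ i j → toℕ i ≡ 0 → suc (toℕ j) ≡ length L → E (vertex j) (vertex i) ≡ true
      closed i j i≡0 j-last = trans (E-vertex j i)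
        (subst₂ (λ x y → onℕ E x y ≡ true)
          (sym (lookup-last (sorted c) (last∈ c) (λ z∈ → proj₂ (bounded c z∈)) j j-last))
          (sym (lookup-first (sorted c) (first∈ c) (λ z∈ → proj₁ (bounded c z∈)) i i≡0))
          closing)

      no-chord : ∀ i j → suc (toℕ i) < toℕ j → ¬ (toℕ i ≡ 0 × suc (toℕ j) ≡ length L) →
                 E (vertex i) (vertex j) ≡ false
      no-chord i j 1+i<j not-closing = trans (E-vertex i j)
        (chordless c (∈-lookup i) (∈-lookup j) (∈-lookup k)
          (lookup-< (sorted c) (subst (toℕ i <_) (sym toℕ-k) ≤-refl))
          (lookup-< (sorted c) (subst (_< toℕ j) (sym toℕ-k) 1+i<j))
          not-ends)
        where
          k : Fin (length L)
          k = fromℕ< (<-trans 1+i<j (toℕ<n j))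
          toℕ-k : toℕ k ≡ suc (toℕ i)
          toℕ-k = toℕ-fromℕ< _
          not-ends : ¬ Ends h l (lookup L i) (lookup L j)
          not-ends (i≡h , j≡l) = not-closing
            ( lookup-first⁻ (sorted c) (λ z∈ → proj₁ (bounded c z∈)) i i≡h
            , lookup-last⁻ (sorted c) (λ z∈ → proj₂ (bounded c z∈)) j j≡l )

module TGonalTiling {m : ℕ} (P : ℕ) (E : Graph m) (tiling : IsTiling (suc (suc P)) E) where

  G : ℕ → ℕ → Bool
  G = onℕ E

  E-sym : ∀ a b → E a b ≡ E b a
  E-sym = proj₁ (proj₁ tiling)

  E-irreflexive : ∀ a → E a a ≡ false
  E-irreflexive = proj₂ (proj₁ tiling)

  hull : HasHullCycle E
  hull = proj₁ (proj₂ (proj₂ tiling))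

  faces : ∀ k v → IsFace E k v → k ≡ suc (suc P)
  faces = proj₂ (proj₂ (proj₂ tiling))

  G-sym : ∀ x y → G x y ≡ G y x
  G-sym = onℕ-sym E E-sym

  hull-step : ∀ u → suc u < m → G u (suc u) ≡ true
  hull-step u 1+u<m = trans (onℕ-fromℕ< E u<m 1+u<m)
    (proj₁ hull _ _ (trans (toℕ-fromℕ< 1+u<m) (cong suc (sym (toℕ-fromℕ< u<m)))))
    where
      u<m : u < m
      u<m = <-trans (n<1+n u) 1+u<m

  hull-outer : ∀ {top} → suc top ≡ m → G 0 top ≡ true
  hull-outer {top} 1+top≡m = trans (G-sym 0 top) (trans (onℕ-fromℕ< E top<m 0<m)
    (proj₂ hull _ _ (toℕ-fromℕ< 0<m) (trans (cong suc (toℕ-fromℕ< top<m)) 1+top≡m)))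
    where
      top<m : top < m
      top<m = subst (top <_) 1+top≡m (n<1+n top)
      0<m : 0 < m
      0<m = ≤-<-trans z≤n top<m

  open Chains G
  open Chain
  open Greedy G hull-step

  cell-length : ∀ {h l L} → Chain (Ends h l) h l L → G h l ≡ true → 3 ≤ length L → length L ≡ suc (suc P)
  cell-length c hl three = faces _ _ (proj₂ (chain-face E c (trans (G-sym _ _) hl) three))

  -- The face below xy is x followed by the greedy path to y from x's farthest neighbour s < y.
  edge-gap-bounded : ∀ f {x y} → x < y → y ≤ x + f → G x y ≡ true → Gap P x y 1
  edge-gap-bounded zero {x} x<y y≤x+0 _ = contradiction (subst (_ ≤_) (+-identityʳ x) y≤x+0) (<⇒≱ x<y)
  edge-gap-bounded (suc f) {x} {suc d} x<1+d 1+d≤x+1+f xy with m≤n⇒m<n∨m≡n (s≤s⁻¹ x<1+d)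
  ... | inj₂ refl = gap-suc x
  ... | inj₁ x<d with farthest x<d (<-trans (n<1+n d) (proj₂ (onℕ-bounded E xy)))
  ...   | s , far with greedyPath (m≤n⇒m≤1+n (Farthest.w≤v far)) (proj₂ (onℕ-bounded E xy))
  ...     | ws , path =
    gap-absorb (gap-trans (edge-gap-bounded f x<s s≤x+f edge)
                          (subst (Gap P s (suc d)) ws-length (greedy-gap path inner)))
    where
      open Farthest far renaming (u<w to x<s; w≤v to s≤d)
      d≤x+f : d ≤ x + f
      d≤x+f = s≤s⁻¹ (subst (suc d ≤_) (+-suc x f) 1+d≤x+1+f)
      s≤x+f : s ≤ x + f
      s≤x+f = ≤-trans s≤d d≤x+f
      rest : Chain (Ends x (suc d)) s (suc d) (s ∷ ws)
      rest = greedy-chain path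
      cross : ∀ {x′ y′} → x′ ∈ x ∷ s ∷ [] → y′ ∈ ws → x′ < s → ¬ Ends x (suc d) x′ y′ → G x′ y′ ≡ false
      cross (here refl) y′∈ _ not-ends with m≤n⇒m<n∨m≡n (proj₂ (bounded rest (there y′∈)))
      ... | inj₁ y′<1+d = beyond (above-first rest y′∈) (s≤s⁻¹ y′<1+d)
      ... | inj₂ y′≡1+d = contradiction (refl , y′≡1+d) not-ends
      cross (there (here refl)) _ s<s _ = contradiction s<s (<-irrefl refl)
      ws-length : length ws ≡ P
      ws-length = suc-injective (suc-injective
        (cell-length (join (edge-chain x<s edge) rest cross) xy (s≤s (s≤s (greedy-nonempty path (s≤s s≤d))))))
      inner : ∀ {x′ y′} → s ≤ x′ → x′ < y′ → y′ ≤ suc d → G x′ y′ ≡ true → Gap P x′ y′ 1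
      inner {x′} {y′} s≤x′ x′<y′ y′≤1+d = edge-gap-bounded f x′<y′ (begin
        y′          ≤⟨ y′≤1+d ⟩
        suc d       ≤⟨ s≤s d≤x+f ⟩
        suc x + f   ≤⟨ +-monoˡ-≤ f (≤-trans x<s s≤x′) ⟩
        x′ + f      ∎)
        where open ≤-Reasoning

  edge-gap : ∀ {x y} → x < y → G x y ≡ true → Gap P x y 1
  edge-gap {x} {y} x<y = edge-gap-bounded y x<y (m≤n+m y x)

  record MinimalEnclosing (a b x y : ℕ) : Set where
    field
      x≤a   : x ≤ a
      b≤y   : b ≤ y
      edge  : G x y ≡ true
      tight : ∀ {x′ y′} → x ≤ x′ → x′ ≤ a → b ≤ y′ → y′ ≤ y → G x′ y′ ≡ true → Ends x y x′ y′

  minimal-enclosing : ∀ {a b} → a ≤ b → b < m → ∃₂ (MinimalEnclosing a b)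
  minimal-enclosing {a} {b} a≤b b<m = pick (minimal-witness encloses? outer)
    where
      Encloses : ℕ → Set
      Encloses g = ∃[ x ] x < suc a × b ≤ x + g × G x (x + g) ≡ true

      encloses? : Decidable Encloses
      encloses? g = anyUpTo? (λ x → (b ≤? x + g) ×-dec (G x (x + g) Bool.≟ true)) (suc a)

      outer : Encloses (pred m)
      outer = 0 , s≤s z≤n , s≤s⁻¹ (subst (b <_) (sym 1+top≡m) b<m) , hull-outer 1+top≡m
        where
          1+top≡m : suc (pred m) ≡ m
          1+top≡m = suc-pred m {{>-nonZero (≤-<-trans z≤n b<m)}}

      pick : ∃[ g ] Encloses g × (∀ {j} → j < g → ¬ Encloses j) → ∃₂ (MinimalEnclosing a b)
      pick (g , (x , x<1+a , b≤x+g , xy) , shortest) =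
        x , x + g , record { x≤a = s≤s⁻¹ x<1+a ; b≤y = b≤x+g ; edge = xy ; tight = tight }
        where
          tight : ∀ {x′ y′} → x ≤ x′ → x′ ≤ a → b ≤ y′ → y′ ≤ x + g → G x′ y′ ≡ true → Ends x (x + g) x′ y′
          tight {x′} {y′} x≤x′ x′≤a b≤y′ y′≤x+g x′y′ =
            ≤-antisym (+-cancelʳ-≤ g x′ x (≤-trans x′+g≤y′ y′≤x+g)) x≤x′ ,
            ≤-antisym y′≤x+g (≤-trans (+-monoˡ-≤ g x≤x′) x′+g≤y′)
            where
              x′+span≡y′ : x′ + (y′ ∸ x′) ≡ y′
              x′+span≡y′ = m+[n∸m]≡n (≤-trans x′≤a (≤-trans a≤b b≤y′))
              g≤span : g ≤ y′ ∸ x′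
              g≤span = ≮⇒≥ λ span<g → shortest span<g
                (x′ , s≤s x′≤a , subst (b ≤_) (sym x′+span≡y′) b≤y′ ,
                 subst (λ y → G x′ y ≡ true) (sym x′+span≡y′) x′y′)
              x′+g≤y′ : x′ + g ≤ y′
              x′+g≤y′ = subst (x′ + g ≤_) x′+span≡y′ (+-monoʳ-≤ x′ g≤span)

  Uncrossed : ℕ → ℕ → Set
  Uncrossed a b = ∀ {x y} → G x y ≡ true → ¬ CrossesAt a b x y

  -- The three greedy paths bound the face containing the segment ab; since that
  -- face is a (P + 2)-gon with a side outside [a, b], the middle path is short.
  middle-path-short : ∀ {a b a′ b′ W₁ W₂ W₃} → a < b → G a b ≡ false → Uncrossed a b →
    MinimalEnclosing a b a′ b′ → GreedyPath a a′ W₁ → GreedyPath b a W₂ → GreedyPath b′ b W₃ →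
    length W₂ ≤ P
  middle-path-short {a} {b} {a′} {b′} {W₁} {W₂} {W₃} a<b ab uncrossed enclosing path₁ path₂ path₃ =
    s≤s⁻¹ (begin
      suc l₂              ≡⟨ +-comm 1 l₂ ⟩
      l₂ + 1              ≤⟨ +-monoʳ-≤ l₂ outside ⟩
      l₂ + (l₁ + l₃)      ≡⟨ rearrange l₁ l₂ l₃ ⟩
      l₁ + l₂ + l₃        ≡⟨ suc-injective (trans (sym face-size) (cell-length face edge three)) ⟩
      suc P               ∎)
    where
      open MinimalEnclosing enclosing
      open ≤-Reasoning
      l₁ = length W₁
      l₂ = length W₂
      l₃ = length W₃

      C₁ : Chain (Ends a′ b′) a′ a (a′ ∷ W₁)
      C₁ = greedy-chain path₁
      C₂ : Chain (Ends a′ b′) a b (a ∷ W₂)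
      C₂ = greedy-chain path₂
      C₃ : Chain (Ends a′ b′) b b′ (b ∷ W₃)
      C₃ = greedy-chain path₃

      cross₁ : ∀ {x y} → x ∈ a′ ∷ W₁ → y ∈ W₂ → x < a → ¬ Ends a′ b′ x y → G x y ≡ false
      cross₁ {x} {y} x∈ y∈ x<a not-ends with G x y in xy
      ... | false = refl
      ... | true with m≤n⇒m<n∨m≡n (proj₂ (bounded C₂ (there y∈)))
      ...   | inj₁ y<b = ⊥-elim (uncrossed xy (crossesAt-from-left a<b x<a (above-first C₂ y∈) y<b))
      ...   | inj₂ refl = ⊥-elim (not-ends (tight (proj₁ (bounded C₁ x∈)) (<⇒≤ x<a) ≤-refl b≤y xy))

      C₁₂ : Chain (Ends a′ b′) a′ b (a′ ∷ W₁ ++ W₂)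
      C₁₂ = join C₁ C₂ cross₁

      cross₂ : ∀ {x y} → x ∈ a′ ∷ W₁ ++ W₂ → y ∈ W₃ → x < b → ¬ Ends a′ b′ x y → G x y ≡ false
      cross₂ {x} {y} x∈ y∈ x<b not-ends with G x y in xy
      ... | false = refl
      ... | true with a <? x
      ...   | yes a<x = ⊥-elim (uncrossed xy (crossesAt-from-right a<b a<x x<b (above-first C₃ y∈)))
      ...   | no a≮x = ⊥-elim (not-ends (tight (proj₁ (bounded C₁₂ x∈)) (≮⇒≥ a≮x)
                                           (<⇒≤ (above-first C₃ y∈)) (proj₂ (bounded C₃ (there y∈))) xy))

      face : Chain (Ends a′ b′) a′ b′ ((a′ ∷ W₁ ++ W₂) ++ W₃)
      face = join C₁₂ C₃ cross₂

      face-size : length ((a′ ∷ W₁ ++ W₂) ++ W₃) ≡ suc (l₁ + l₂ + l₃)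
      face-size = trans (length-++ (a′ ∷ W₁ ++ W₂)) (cong (λ k → suc k + l₃) (length-++ W₁))

      three : 3 ≤ length ((a′ ∷ W₁ ++ W₂) ++ W₃)
      three = subst (3 ≤_) (sym face-size)
        (s≤s (≤-trans (greedy-long path₂ a<b ab) (≤-trans (m≤n+m l₂ l₁) (m≤m+n (l₁ + l₂) l₃))))

      outside : 1 ≤ l₁ + l₃
      outside = nonempty path₁ path₃
        where
          nonempty : ∀ {V₁ V₃} → GreedyPath a a′ V₁ → GreedyPath b′ b V₃ → 1 ≤ length V₁ + length V₃
          nonempty {_ ∷ _} _ _ = s≤s z≤n
          nonempty {[]} {_ ∷ _} _ _ = s≤s z≤n
          nonempty {[]} {[]} p₁ p₃ = contradiction
            (trans (sym ab) (subst₂ (λ x y → G x y ≡ true) (greedy-[] p₁) (sym (greedy-[] p₃)) edge)) λ ()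

      rearrange : ∀ l₁ l₂ l₃ → l₂ + (l₁ + l₃) ≡ l₁ + l₂ + l₃
      rearrange = solve-∀

  uncrossed-edge : ∀ {a b} → a < b → b < m → Gap P a b 1 → Uncrossed a b → G a b ≡ true
  uncrossed-edge {a} {b} a<b b<m gap₁ uncrossed with G a b in ab
  ... | true = refl
  ... | false with minimal-enclosing (<⇒≤ a<b) b<m
  ...   | a′ , b′ , enclosing
          with greedyPath (MinimalEnclosing.x≤a enclosing) (<-trans a<b b<m)
             | greedyPath (<⇒≤ a<b) b<m
             | greedyPath (MinimalEnclosing.b≤y enclosing) (proj₂ (onℕ-bounded E (MinimalEnclosing.edge enclosing)))
  ...     | _ , path₁ | _ , path₂ | _ , path₃ =
    ⊥-elim (gap-unique gap₁ (greedy-gap path₂ (λ _ x<y _ → edge-gap x<y)) (greedy-long path₂ a<b ab)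
             (s≤s (middle-path-short a<b ab uncrossed enclosing path₁ path₂ path₃)))

bool-ext : ∀ {x y : Bool} → (x ≡ true → y ≡ true) → (y ≡ true → x ≡ true) → x ≡ y
bool-ext {false} {false} _ _ = refl
bool-ext {false} {true} _ y⇒x = y⇒x refl
bool-ext {true} {_} x⇒y _ = sym (x⇒y refl)

module CoplanarTilings {m P : ℕ} {T E₁ E₂ : Graph m} (plane : Plane T)
  (tiling₁ : IsTiling (suc (suc P)) E₁) (E₁⊆T : SubgraphOf E₁ T)
  (tiling₂ : IsTiling (suc (suc P)) E₂) (E₂⊆T : SubgraphOf E₂ T) where

  module Tiling₁ = TGonalTiling P E₁ tiling₁
  module Tiling₂ = TGonalTiling P E₂ tiling₂

  uncrossed : ∀ {a b} → E₁ a b ≡ true → Tiling₂.Uncrossed (toℕ a) (toℕ b)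
  uncrossed {a} {b} ab {x} {y} xy with onℕ-bounded E₂ xy
  ... | x<m , y<m = subst₂ (λ x y → ¬ CrossesAt (toℕ a) (toℕ b) x y) (toℕ-fromℕ< x<m) (toℕ-fromℕ< y<m)
    (plane a b _ _ (E₁⊆T a b ab) (E₂⊆T _ _ (trans (sym (onℕ-fromℕ< E₂ x<m y<m)) xy)))

  ordered-edge : ∀ {a b} → toℕ a < toℕ b → E₁ a b ≡ true → E₂ a b ≡ true
  ordered-edge {a} {b} a<b ab = trans (sym (onℕ-toℕ E₂ a b))
    (Tiling₂.uncrossed-edge a<b (toℕ<n b) (Tiling₁.edge-gap a<b (trans (onℕ-toℕ E₁ a b) ab)) (uncrossed ab))

  E₁⊆E₂ : SubgraphOf E₁ E₂
  E₁⊆E₂ a b ab with <-cmp (toℕ a) (toℕ b)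
  ... | tri< a<b _ _ = ordered-edge a<b ab
  ... | tri≈ _ a≡b _ =
    contradiction (trans (sym ab) (trans (cong (E₁ a) (sym (toℕ-injective a≡b))) (Tiling₁.E-irreflexive a)))
                  λ ()
  ... | tri> _ _ b<a = trans (Tiling₂.E-sym a b) (ordered-edge b<a (trans (Tiling₁.E-sym b a) ab))

lemma2 : (t n : ℕ) → 3 ≤ t → (T : Graph (n + 2)) → IsTriangulation T →
    (E₁ E₂ : Graph (n + 2)) →
    IsTiling t E₁ → SubgraphOf E₁ T →
    IsTiling t E₂ → SubgraphOf E₂ T →
    ∀ (a b : Fin (n + 2)) → E₁ a b ≡ E₂ a b
lemma2 t n (s≤s (s≤s (s≤s _))) T (_ , plane , _) E₁ E₂ tiling₁ E₁⊆T tiling₂ E₂⊆T a b =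
  bool-ext (CoplanarTilings.E₁⊆E₂ plane tiling₁ E₁⊆T tiling₂ E₂⊆T a b)
           (CoplanarTilings.E₁⊆E₂ plane tiling₂ E₂⊆T tiling₁ E₁⊆T a b)
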